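{- Let $G$ be a finite abelian group with identity $1$, let $S$ be an inverse-closed subset of $G\setminus\{1\}$ with $|S|\ge 3$, let $s\in S$ be such that $H=\langle S\setminus\{s,s^{ -1}\}\rangle\neq G$, let $\Gamma=\mathrm{Cay}(G;S)$ and $\Gamma_1=\mathrm{Cay}(H;S\setminus\{s,s^2,s^3\})$. Suppose $[G:H]=2$, $s$ has order $4$, $G\neq\langle s\rangle$, and $\Gamma$ is distance-regular with $a_1=2$. If for some (equivalently every) $x\in H$ the vertices $x$ and $xs^2$ lie in different connected components of $\Gamma_1$, let $d$ be the diameter of a connected component of $\Gamma_1$; otherwise let $d=\lfloor(\partial_1(x,xs^2)-1)/2\rfloor$. Then $c_{d+1}=d+1$. Moreover, if $x$ and $xs^2$ are not in the same connected component of $\Gamma_1$, then $a_{d+1}=2(d+1)$.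
   Context: $\mathrm{Cay}(G;S)$ has vertex set $G$, $g\sim h$ iff $h=gs'$ for some $s'\in S$. $\partial_1$ is the path-length distance of $\Gamma_1$. A connected graph is distance-regular if for each $i$ up to the diameter the numbers $c_i(x,y)=|N_{i-1}(x)\cap N(y)|$, $a_i(x,y)=|N_i(x)\cap N(y)|$, $b_i(x,y)=|N_{i+1}(x)\cap N(y)|$ depend only on the distance $i$ between $x$ and $y$; their values are the intersection numbers $c_i,a_i,b_i$. -}

module Defs where

open import Data.Nat using (ℕ; zero; suc; _+_; _*_; _∸_; _≤_; _<_) public
open import Data.Nat.DivMod using (_/_) public
open import Data.Fin using (Fin)
open import Data.List using (List; length)
open import Data.List.Membership.Propositional using (_∈_)
open import Data.List.Relation.Unary.Unique.Propositional using (Unique)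
open import Data.Product using (Σ; ∃; ∃-syntax; _×_; _,_) public
open import Data.Sum using (_⊎_) public
open import Data.Empty using (⊥)
open import Function.Bundles using (_↔_; _⇔_)
open import Algebra.Structures using (IsAbelianGroup)
open import Relation.Binary.PropositionalEquality using (_≡_; _≢_) public
open import Relation.Nullary using (¬_) public

record FinAbGroup : Set₁ where
  infixl 7 _∙_
  field
    Carrier        : Set
    _∙_            : Carrier → Carrier → Carrier
    ε              : Carrier
    _⁻¹            : Carrier → Carrier
    isAbelianGroup : IsAbelianGroup _≡_ _∙_ ε _⁻¹
    size           : ℕ
    finite         : Carrier ↔ Fin size

module _ (G : FinAbGroup) where
  open FinAbGroup G

  pow : Carrier → ℕ → Carrier
  pow g zero    = ε
  pow g (suc k) = g ∙ pow g k

  HasOrder : Carrier → ℕ → Set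
  HasOrder g k = (0 < k) × (pow g k ≡ ε) × (∀ j → 0 < j → j < k → pow g j ≢ ε)

  HasCard : (Carrier → Set) → ℕ → Set
  HasCard P k = Σ (List Carrier) λ l → Unique l × length l ≡ k × (∀ z → (z ∈ l) ⇔ P z)

  data Gen (A : Carrier → Set) : Carrier → Set where
    gen-ε   : Gen A ε
    gen-mul : ∀ {g a} → Gen A g → A a → Gen A (g ∙ a)
    gen-inv : ∀ {g} → Gen A g → Gen A (g ⁻¹)

  CayAdj : (Carrier → Set) → Carrier → Carrier → Set
  CayAdj S g h = ∃[ t ] (S t × h ≡ g ∙ t)

  data Walk (S : Carrier → Set) : Carrier → Carrier → ℕ → Set where
    nil  : ∀ {x} → Walk S x x 0
    cons : ∀ {x y z k} → CayAdj S x y → Walk S y z k → Walk S x z (suc k)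

  Dist : (Carrier → Set) → Carrier → Carrier → ℕ → Set
  Dist S x y k = Walk S x y k × (∀ m → m < k → ¬ Walk S x y m)

  Reach : (Carrier → Set) → Carrier → Carrier → Set
  Reach S x y = ∃[ k ] Walk S x y k

  Connected : (Carrier → Set) → Set
  Connected S = ∀ x y → Reach S x y

  IsDiameter : (Carrier → Set) → ℕ → Set
  IsDiameter S D = (∀ x y k → Dist S x y k → k ≤ D) × (∃[ x ] ∃[ y ] Dist S x y D)

  IsComponentDiameter : (Carrier → Set) → Carrier → ℕ → Set
  IsComponentDiameter S x d =
    (∀ u v k → Reach S x u → Reach S x v → Dist S u v k → k ≤ d) ×
    (∃[ u ] ∃[ v ] (Reach S x u × Reach S x v × Dist S u v d))

  CSet : (Carrier → Set) → ℕ → Carrier → Carrier → Carrier → Set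
  CSet S zero    x y z = ⊥
  CSet S (suc j) x y z = Dist S x z j × CayAdj S y z

  ASet : (Carrier → Set) → ℕ → Carrier → Carrier → Carrier → Set
  ASet S i x y z = Dist S x z i × CayAdj S y z

  BSet : (Carrier → Set) → ℕ → Carrier → Carrier → Carrier → Set
  BSet S i x y z = Dist S x z (suc i) × CayAdj S y z

  CNum ANum BNum : (Carrier → Set) → ℕ → ℕ → Set
  CNum S i v = ∀ x y → Dist S x y i → HasCard (CSet S i x y) v
  ANum S i v = ∀ x y → Dist S x y i → HasCard (ASet S i x y) v
  BNum S i v = ∀ x y → Dist S x y i → HasCard (BSet S i x y) v

  DistanceRegular : (Carrier → Set) → Set
  DistanceRegular S =
    Connected S × (∃[ D ] (IsDiameter S D ×
      (∀ i → i ≤ D → ∃[ c ] ∃[ a ] ∃[ b ] (CNum S i c × ANum S i a × BNum S i b))))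

  IntersectionC IntersectionA : (Carrier → Set) → ℕ → ℕ → Set
  IntersectionC S i v = (∃[ D ] (IsDiameter S D × i ≤ D)) × CNum S i v
  IntersectionA S i v = (∃[ D ] (IsDiameter S D × i ≤ D)) × ANum S i v

module Submission where

-- Lemma 7.8.  Write T = S ∖ {s, s², s³} for the generators of Γ₁ = Cay(H; T) and σ e = s^e for e ∈ ℤ₄.
-- Since G is abelian, T ⊆ H and s ∉ H, an S-walk from ε to w s^e (w ∈ H) rearranges into a T-walk to
-- w s^k followed by steps by powers of s; as s^k ∈ H only for even k, the walk must pass through w or
-- w s² (parity-decomposition).  This expresses Γ-distances near a coset w⟨s⟩ through Γ₁-distances.
-- Call u an anchor at level j if ∂₁(ε, u) = j and ∂₁(ε, u s²) > j.  Around an anchor,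
--   C_{j+1}(ε, u s) = {u} ∪ C_j(ε, u)·s,  and, if s² ∈ S and ∂₁(ε, u s²) > j + 1,
--   A_{j+1}(ε, u s) = {u s², u s³} ∪ A_j(ε, u)·s,
-- so c_{j+1} = c_j + 1 and a_{j+1} = a_j + 2 (module Layer).  Anchors exist at all levels j ≤ d:
-- along a Γ₁-geodesic from ε to s² when ∂₁(x, x s²) is finite, and with unlimited slack along any
-- geodesic of the component when x s² is unreachable.  Induction on the level then gives c_{d+1} = d + 1
-- and a_{d+1} = 2(d + 1); the hypothesis a₁ = 2 is only used to show s² ∈ S.

open import Defs
open import Data.Nat using (ℕ; NonZero)
open import Data.Nat using (zero; suc; s≤s; z≤n; _≤?_)
open import Data.Nat.DivMod using (m/n*n≤m)
open import Data.Nat.Properties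
  using (≤-refl; ≤-reflexive; ≤-trans; ≤-antisym; ≤-pred; <⇒≤; <⇒≱; ≤⇒≯; ≰⇒>; n≤1+n; m≤m+n; m≤n+m;
         suc-injective; 1+n≢n; +-suc; +-monoˡ-≤; +-monoʳ-≤; +-monoˡ-<; +-cancelʳ-≤; m+n≤o⇒n≤o; m+[n∸m]≡n;
         *-comm; *-suc; *-identityʳ; *-monoˡ-≤)
import Data.Fin as Fin
open import Data.List using (List; []; _∷_; length; map)
open import Data.List.Properties using (length-map)
open import Data.List.Membership.Propositional using (_∈_)
open import Data.List.Membership.Propositional.Properties using (∈-map⁺; ∈-map⁻)
open import Data.List.Membership.Propositional.Properties.WithK using (unique∧set⇒bag)
open import Data.List.Relation.Binary.BagAndSetEquality using (∼bag⇒↭)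
open import Data.List.Relation.Binary.Permutation.Propositional.Properties using (↭-length)
open import Data.List.Relation.Unary.Any using (here; there)
import Data.List.Relation.Unary.All as All
open import Data.List.Relation.Unary.AllPairs using (_∷_)
open import Data.List.Relation.Unary.Unique.Propositional using (Unique)
open import Data.List.Relation.Unary.Unique.Propositional.Properties using (map⁺)
open import Data.Product using (proj₁; proj₂)
open import Data.Sum using (inj₁; inj₂)
open import Data.Empty using (⊥-elim)
open import Function.Bundles using (_⇔_; mk⇔; Equivalence)
open import Function.Properties.Equivalence using () renaming (refl to ⇔-refl; trans to ⇔-trans; sym to ⇔-sym)
open import Function.Properties.Inverse using (↔⇒↣)
open import Algebra.Bundles using (AbelianGroup)
open import Algebra.Structures using (IsAbelianGroup)
open import Relation.Binary.PropositionalEquality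
  using (refl; sym; trans; cong; subst; module ≡-Reasoning)
open import Relation.Nullary using (Dec; yes; no)
open import Relation.Nullary.Decidable using (via-injection)

module Counting {A : Set} where

  Count : (A → Set) → ℕ → Set
  Count P c = Σ (List A) λ l → Unique l × length l ≡ c × (∀ z → (z ∈ l) ⇔ P z)

  -- the number of elements is well defined: duplicate-free lists with the same members are permutations
  count-unique : ∀ {P a b} → Count P a → Count P b → a ≡ b
  count-unique (l₁ , u₁ , e₁ , m₁) (l₂ , u₂ , e₂ , m₂) =
    trans (sym e₁) (trans (↭-length (∼bag⇒↭ (unique∧set⇒bag u₁ u₂ λ {z} → ⇔-trans (m₁ z) (⇔-sym (m₂ z))))) e₂)

  count-empty : ∀ {P a} → (∀ z → ¬ P z) → Count P a → a ≡ 0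
  count-empty none ([] , _ , e , _) = sym e
  count-empty none ((z ∷ _) , _ , _ , m) = ⊥-elim (none z (Equivalence.to (m z) (here refl)))

  count-inhabited : ∀ {P c} → Count P (suc c) → ∃[ z ] P z
  count-inhabited ((z ∷ _) , _ , _ , m) = z , Equivalence.to (m z) (here refl)

  count-insert : ∀ {P Q c} (a : A) → Count P c → ¬ P a → (∀ z → Q z ⇔ (z ≡ a ⊎ P z)) → Count Q (suc c)
  count-insert {P} {Q} a (l , u , e , m) a∉P q⇔ =
    (a ∷ l) , (All.tabulate a-fresh ∷ u) , cong suc e , λ z → ⇔-trans (members z) (⇔-sym (q⇔ z))
    where
    a-fresh : ∀ {z} → z ∈ l → ¬ a ≡ z
    a-fresh {z} z∈l refl = a∉P (Equivalence.to (m z) z∈l)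
    members : ∀ z → (z ∈ a ∷ l) ⇔ (z ≡ a ⊎ P z)
    members z = mk⇔ to from
      where
      to : z ∈ a ∷ l → z ≡ a ⊎ P z
      to (here z≡a) = inj₁ z≡a
      to (there z∈l) = inj₂ (Equivalence.to (m z) z∈l)
      from : z ≡ a ⊎ P z → z ∈ a ∷ l
      from (inj₁ z≡a) = here z≡a
      from (inj₂ pz) = there (Equivalence.from (m z) pz)

  count-image : ∀ {P c} (f : A → A) → (∀ {x y} → f x ≡ f y → x ≡ y) → Count P c →
    Count (λ z → ∃[ w ] (P w × z ≡ f w)) c
  count-image {P} f f-inj (l , u , e , m) =
    map f l , map⁺ f-inj u , trans (length-map f l) e , λ z → mk⇔ (to z) (from z)
    where
    to : ∀ z → z ∈ map f l → ∃[ w ] (P w × z ≡ f w)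
    to z z∈ with ∈-map⁻ f z∈
    ... | w , w∈l , z≡fw = w , Equivalence.to (m w) w∈l , z≡fw
    from : ∀ z → ∃[ w ] (P w × z ≡ f w) → z ∈ map f l
    from z (w , pw , refl) = ∈-map⁺ f (Equivalence.from (m w) pw)

module GroupFacts (G : FinAbGroup) where
  open FinAbGroup G

  asAbelianGroup : AbelianGroup _ _
  asAbelianGroup = record
    { Carrier = Carrier ; _≈_ = _≡_ ; _∙_ = _∙_ ; ε = ε ; _⁻¹ = _⁻¹ ; isAbelianGroup = isAbelianGroup }

  open import Algebra.Properties.AbelianGroup asAbelianGroup public
    using (∙-cancelˡ; ∙-cancelʳ; inverseʳ-unique; ⁻¹-involutive; ⁻¹-∙-comm;
           \\-leftDividesʳ; //-rightDividesʳ)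

  _≟_ : (x y : Carrier) → Dec (x ≡ y)
  _≟_ = via-injection (↔⇒↣ finite) Fin._≟_

  open IsAbelianGroup isAbelianGroup using (assoc; comm; identityʳ)

  swapʳ : ∀ a b c → (a ∙ b) ∙ c ≡ (a ∙ c) ∙ b
  swapʳ a b c = trans (assoc a b c) (trans (cong (a ∙_) (comm b c)) (sym (assoc a c b)))

  gen-closed : ∀ {A g h} → Gen G A g → Gen G A h → Gen G A (g ∙ h)
  gen-closed {A} {g} Gg gen-ε = subst (Gen G A) (sym (identityʳ g)) Gg
  gen-closed {A} {g} Gg (gen-mul {h} {a} Gh Aa) = subst (Gen G A) (assoc g h a) (gen-mul (gen-closed Gg Gh) Aa)
  gen-closed {A} {g} Gg (gen-inv {h} Gh) = subst (Gen G A) g∙h⁻¹ (gen-inv (gen-closed (gen-inv Gg) Gh))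
    where
    g∙h⁻¹ : (g ⁻¹ ∙ h) ⁻¹ ≡ g ∙ h ⁻¹
    g∙h⁻¹ = sym (trans (cong (_∙ h ⁻¹) (sym (⁻¹-involutive g))) (⁻¹-∙-comm (g ⁻¹) h))

  walk-in-subgroup : ∀ {A B : Carrier → Set} → (∀ {t} → A t → Gen G B t) →
    ∀ {x y n} → Walk G A x y n → Gen G B x → Gen G B y
  walk-in-subgroup A⊆B nil Bx = Bx
  walk-in-subgroup A⊆B (cons (t , At , refl) w) Bx = walk-in-subgroup A⊆B w (gen-closed Bx (A⊆B At))

module CayleyWalks (G : FinAbGroup) where
  open FinAbGroup G
  open IsAbelianGroup isAbelianGroup using (assoc; comm; identityʳ)
  open GroupFacts G using (\\-leftDividesʳ; //-rightDividesʳ)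

  module _ {A : Carrier → Set} where

    snoc : ∀ {x y z n} → Walk G A x y n → CayAdj G A y z → Walk G A x z (suc n)
    snoc nil step = cons step nil
    snoc (cons step′ w) step = cons step′ (snoc w step)

    _++ʷ_ : ∀ {x y z m n} → Walk G A x y m → Walk G A y z n → Walk G A x z (m + n)
    nil ++ʷ w = w
    cons step w₁ ++ʷ w₂ = cons step (w₁ ++ʷ w₂)

    split : ∀ {x z} j k → Walk G A x z (j + k) → ∃[ y ] (Walk G A x y j × Walk G A y z k)
    split zero k w = _ , nil , w
    split (suc j) k (cons step w) with split j k w
    ... | y , w₁ , w₂ = y , cons step w₁ , w₂

    walk-zero : ∀ {x y} → Walk G A x y 0 → x ≡ y
    walk-zero nil = refl

    translate : ∀ g {x y x′ y′ n} → x′ ≡ g ∙ x → y′ ≡ g ∙ y → Walk G A x y n → Walk G A x′ y′ n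
    translate g refl refl nil = nil
    translate g refl refl (cons (t , At , refl) w) = cons (t , At , sym (assoc g _ t)) (translate g refl refl w)

    dist-lb : ∀ {x y m n} → Dist G A x y m → Walk G A x y n → m ≤ n
    dist-lb {m = m} {n} (_ , shortest) w with m ≤? n
    ... | yes m≤n = m≤n
    ... | no m≰n = ⊥-elim (shortest n (≰⇒> m≰n) w)

    mkDist : ∀ {x y m} → Walk G A x y m → (∀ n → Walk G A x y n → m ≤ n) → Dist G A x y m
    mkDist w lb = w , λ n n<m wn → <⇒≱ n<m (lb n wn)

    dist-unique : ∀ {x y m n} → Dist G A x y m → Dist G A x y n → m ≡ n
    dist-unique dm dn = ≤-antisym (dist-lb dm (proj₁ dn)) (dist-lb dn (proj₁ dm))

    dist-translate : ∀ g {x y x′ y′ n} → x′ ≡ g ∙ x → y′ ≡ g ∙ y → Dist G A x y n → Dist G A x′ y′ n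
    dist-translate g {x} {y} x′≡ y′≡ (w , shortest) =
      translate g x′≡ y′≡ w ,
      λ m m<n w′ → shortest m m<n (translate (g ⁻¹) (back x′≡) (back y′≡) w′)
      where
      back : ∀ {v v′} → v′ ≡ g ∙ v → v ≡ g ⁻¹ ∙ v′
      back {v} refl = sym (\\-leftDividesʳ g v)

    dist-prefix : ∀ {x v D} j → j ≤ D → Dist G A x v D → ∃[ u ] Dist G A x u j
    dist-prefix {D = D} j j≤D (w , shortest) with split j (D ∸ j) (subst (Walk G A _ _) (sym (m+[n∸m]≡n j≤D)) w)
    ... | u , w₁ , w₂ = u , w₁ , λ m m<j w′ →
      shortest (m + (D ∸ j)) (subst (m + (D ∸ j) <_) (m+[n∸m]≡n j≤D) (+-monoˡ-< (D ∸ j) m<j)) (w′ ++ʷ w₂)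

    CSet-pred : ∀ {i x y w} → CSet G A i x y w → ∃[ i′ ] (i ≡ suc i′ × Dist G A x w i′ × CayAdj G A y w)
    CSet-pred {suc i′} (dw , adj) = i′ , refl , dw , adj

    dist-of-predecessor : ∀ {x y z i n} → CayAdj G A z y → Dist G A x y i → Walk G A x z n → suc n ≤ i →
      i ≡ suc n × Dist G A x z n
    dist-of-predecessor z~y dy w n<i =
      ≤-antisym (dist-lb dy (snoc w z~y)) n<i ,
      mkDist w (λ m w′ → ≤-pred (≤-trans n<i (dist-lb dy (snoc w′ z~y))))

  widen : ∀ {A B : Carrier → Set} → (∀ {t} → A t → B t) → ∀ {x y n} → Walk G A x y n → Walk G B x y n
  widen A⊆B nil = nil
  widen A⊆B (cons (t , At , e) w) = cons (t , A⊆B At , e) (widen A⊆B w)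

  module _ {A : Carrier → Set} (A-inv : ∀ {t} → A t → A (t ⁻¹)) where

    reverse : ∀ {x y n} → Walk G A x y n → Walk G A y x n
    reverse nil = nil
    reverse (cons {x} (t , At , refl) w) = snoc (reverse w) (t ⁻¹ , A-inv At , sym (//-rightDividesʳ t x))

    detour : ∀ {u g j n} → Walk G A ε u j → Walk G A ε (u ∙ g) n → Walk G A ε g (n + j)
    detour {u} {g} to-u to-ug = to-ug ++ʷ translate g (comm u g) (sym (identityʳ g)) (reverse to-u)

-- residues modulo 4: the exponents of an element of order 4
data ℤ₄ : Set where
  0₄ 1₄ 2₄ 3₄ : ℤ₄

toℕ₄ : ℤ₄ → ℕ
toℕ₄ 0₄ = 0
toℕ₄ 1₄ = 1
toℕ₄ 2₄ = 2
toℕ₄ 3₄ = 3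

reduce : ℕ → ℤ₄
reduce 0 = 0₄
reduce 1 = 1₄
reduce 2 = 2₄
reduce 3 = 3₄
reduce (suc (suc (suc (suc n)))) = reduce n

_+₄_ : ℤ₄ → ℤ₄ → ℤ₄
a +₄ b = reduce (toℕ₄ a + toℕ₄ b)

-₄_ : ℤ₄ → ℤ₄
-₄ 0₄ = 0₄
-₄ 1₄ = 3₄
-₄ 2₄ = 2₄
-₄ 3₄ = 1₄

+₄-identityʳ : ∀ a → a +₄ 0₄ ≡ a
+₄-identityʳ 0₄ = refl
+₄-identityʳ 1₄ = refl
+₄-identityʳ 2₄ = refl
+₄-identityʳ 3₄ = refl

+₄-inverseʳ : ∀ a → a +₄ (-₄ a) ≡ 0₄
+₄-inverseʳ 0₄ = refl
+₄-inverseʳ 1₄ = refl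
+₄-inverseʳ 2₄ = refl
+₄-inverseʳ 3₄ = refl

-- at least this many steps by powers of s are needed to multiply by s^k: none for k = 0, one otherwise
weight : ℤ₄ → ℕ
weight 0₄ = 0
weight _  = 1

weight≤1 : ∀ a → weight a ≤ 1
weight≤1 0₄ = z≤n
weight≤1 1₄ = s≤s z≤n
weight≤1 2₄ = s≤s z≤n
weight≤1 3₄ = s≤s z≤n

-- if e + k = 0 then weight k ≥ weight e, and if e + k = 2 then weight k ≥ weight (e + 2):
-- only k = 0 has weight 0, and then e is 0 (resp. 2)
parity-cost : ∀ e k → (e +₄ k ≡ 0₄ → weight e ≤ weight k) × (e +₄ k ≡ 2₄ → weight (e +₄ 2₄) ≤ weight k)
parity-cost e 0₄ =
  (λ e≡0 → ≤-reflexive (cong weight (trans (sym (+₄-identityʳ e)) e≡0))) ,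
  (λ e≡2 → ≤-reflexive (cong (λ a → weight (a +₄ 2₄)) (trans (sym (+₄-identityʳ e)) e≡2)))
parity-cost e 1₄ = (λ _ → weight≤1 e) , (λ _ → weight≤1 (e +₄ 2₄))
parity-cost e 2₄ = (λ _ → weight≤1 e) , (λ _ → weight≤1 (e +₄ 2₄))
parity-cost e 3₄ = (λ _ → weight≤1 e) , (λ _ → weight≤1 (e +₄ 2₄))

module PowersOfOrderFour (G : FinAbGroup) (s : FinAbGroup.Carrier G) (s⁴≡ε : pow G s 4 ≡ FinAbGroup.ε G) where
  open FinAbGroup G
  open IsAbelianGroup isAbelianGroup using (assoc; identityˡ; identityʳ)
  open GroupFacts G using (inverseʳ-unique)
  open ≡-Reasoning

  σ : ℤ₄ → Carrier
  σ e = pow G s (toℕ₄ e)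

  σ1≡s : σ 1₄ ≡ s
  σ1≡s = identityʳ s

  pow-+ : ∀ m n → pow G s (m + n) ≡ pow G s m ∙ pow G s n
  pow-+ zero n = sym (identityˡ _)
  pow-+ (suc m) n = trans (cong (s ∙_) (pow-+ m n)) (sym (assoc s _ _))

  pow-reduce : ∀ n → pow G s n ≡ σ (reduce n)
  pow-reduce 0 = refl
  pow-reduce 1 = refl
  pow-reduce 2 = refl
  pow-reduce 3 = refl
  pow-reduce (suc (suc (suc (suc n)))) = begin
    pow G s (4 + n)            ≡⟨ pow-+ 4 n ⟩
    pow G s 4 ∙ pow G s n      ≡⟨ cong (_∙ pow G s n) s⁴≡ε ⟩
    ε ∙ pow G s n              ≡⟨ identityˡ _ ⟩
    pow G s n                  ≡⟨ pow-reduce n ⟩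
    σ (reduce n)               ∎

  σ-+ : ∀ a b → σ a ∙ σ b ≡ σ (a +₄ b)
  σ-+ a b = trans (sym (pow-+ (toℕ₄ a) (toℕ₄ b))) (pow-reduce (toℕ₄ a + toℕ₄ b))

  σ-inverse : ∀ a → σ (-₄ a) ≡ σ a ⁻¹
  σ-inverse a = inverseʳ-unique (σ a) (σ (-₄ a)) (trans (σ-+ a (-₄ a)) (cong σ (+₄-inverseʳ a)))

  σ-shift : ∀ w a b → (w ∙ σ a) ∙ σ b ≡ w ∙ σ (a +₄ b)
  σ-shift w a b = trans (assoc w (σ a) (σ b)) (cong (w ∙_) (σ-+ a b))

  σ-unshift : ∀ {z w} a → z ≡ w ∙ σ a → w ≡ z ∙ σ (-₄ a)
  σ-unshift {w = w} a refl = sym (begin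
    (w ∙ σ a) ∙ σ (-₄ a)   ≡⟨ σ-shift w a (-₄ a) ⟩
    w ∙ σ (a +₄ (-₄ a))    ≡⟨ cong (λ c → w ∙ σ c) (+₄-inverseʳ a) ⟩
    w ∙ ε                  ≡⟨ identityʳ w ⟩
    w                      ∎)

double-≤ : ∀ {j m} → j ≤ m / 2 → j + j ≤ m
double-≤ {j} {m} j≤m/2 = subst (_≤ m) (trans (*-suc j 1) (cong (j +_) (*-identityʳ j)))
  (≤-trans (*-monoˡ-≤ 2 j≤m/2) (m/n*n≤m m 2))

arithmetic-progression : (Val : ℕ → ℕ → Set) (δ N : ℕ) →
  (∀ v → Val 0 v → v ≡ 0) →
  (∀ j → j < N → ∀ v → Val (suc j) v → ∃[ v₀ ] (Val j v₀ × v ≡ δ + v₀)) →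
  ∀ i → i ≤ N → ∀ v → Val i v → v ≡ i * δ
arithmetic-progression Val δ N base step zero _ v val = base v val
arithmetic-progression Val δ N base step (suc j) j<N v val with step j j<N v val
... | v₀ , val₀ , refl = cong (δ +_) (arithmetic-progression Val δ N base step j (<⇒≤ j<N) v₀ val₀)

-- if S generates G and H = ⟨S ∖ {s, s⁻¹}⟩ is proper, then s ∉ H (otherwise S ⊆ H)
generator-outside : (G : FinAbGroup) (S : FinAbGroup.Carrier G → Set) (s : FinAbGroup.Carrier G) →
  let open FinAbGroup G
      H = Gen G (λ g → S g × g ≢ s × g ≢ s ⁻¹)
  in Connected G S → (∃[ g ] ¬ H g) → ¬ H s
generator-outside G S s connected (g , g∉H) s∈H =
  g∉H (walk-in-subgroup S⊆H (proj₂ (connected ε g)) gen-ε)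
  where
  open FinAbGroup G
  open IsAbelianGroup isAbelianGroup using (identityˡ)
  open GroupFacts G using (_≟_; walk-in-subgroup)
  S⊆H : ∀ {t} → S t → Gen G (λ g → S g × g ≢ s × g ≢ s ⁻¹) t
  S⊆H {t} St with t ≟ s | t ≟ (s ⁻¹)
  ... | yes refl | _ = s∈H
  ... | no _ | yes refl = gen-inv s∈H
  ... | no t≢s | no t≢s⁻¹ = subst (Gen G _) (identityˡ t) (gen-mul gen-ε (St , t≢s , t≢s⁻¹))

module CosetGeometry (G : FinAbGroup) (S : FinAbGroup.Carrier G → Set) (s : FinAbGroup.Carrier G)
  (S-inv : ∀ g → S g → S (FinAbGroup._⁻¹ G g)) (ε∉S : ¬ S (FinAbGroup.ε G)) (s∈S : S s)
  (s⁴≡ε : pow G s 4 ≡ FinAbGroup.ε G)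
  (s∉H : ¬ Gen G (λ g → S g × g ≢ s × g ≢ FinAbGroup._⁻¹ G s) s) where

  open FinAbGroup G
  open IsAbelianGroup isAbelianGroup using (comm; identityˡ; identityʳ; inverseˡ)
  open GroupFacts G
  open CayleyWalks G
  open PowersOfOrderFour G s s⁴≡ε
  open Counting

  H : Carrier → Set
  H = Gen G (λ g → S g × g ≢ s × g ≢ s ⁻¹)

  T : Carrier → Set
  T g = S g × g ≢ s × g ≢ pow G s 2 × g ≢ pow G s 3

  dist-at : ∀ {A : Carrier → Set} {x y i} → x ≡ y → Dist G A ε x i → Dist G A ε y i
  dist-at {A} {i = i} = subst (λ v → Dist G A ε v i)

  σ3≡s⁻¹ : σ 3₄ ≡ s ⁻¹
  σ3≡s⁻¹ = trans (σ-inverse 1₄) (cong _⁻¹ σ1≡s)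

  σ1∈S : S (σ 1₄)
  σ1∈S = subst S (sym σ1≡s) s∈S

  σ3∈S : S (σ 3₄)
  σ3∈S = subst S (sym σ3≡s⁻¹) (S-inv s s∈S)

  T⊆S : ∀ {t} → T t → S t
  T⊆S = proj₁

  T-intro : ∀ {t} → S t → (∀ e → t ≢ σ e) → T t
  T-intro St t≢σ = St , (λ t≡s → t≢σ 1₄ (trans t≡s (sym σ1≡s))) , t≢σ 2₄ , t≢σ 3₄

  T-not-power : ∀ {t} → T t → ∀ e → t ≢ σ e
  T-not-power (St , _ , _ , _) 0₄ t≡ε = ε∉S (subst S t≡ε St)
  T-not-power (_ , t≢s , _ , _) 1₄ t≡σ1 = t≢s (trans t≡σ1 σ1≡s)
  T-not-power (_ , _ , t≢s² , _) 2₄ = t≢s²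
  T-not-power (_ , _ , _ , t≢s³) 3₄ = t≢s³

  classify : ∀ {t} → S t → T t ⊎ ∃[ e ] (t ≡ σ e)
  classify {t} St with t ≟ s | t ≟ σ 2₄ | t ≟ σ 3₄
  ... | yes t≡s | _ | _ = inj₂ (1₄ , trans t≡s (sym σ1≡s))
  ... | no _ | yes t≡s² | _ = inj₂ (2₄ , t≡s²)
  ... | no _ | no _ | yes t≡s³ = inj₂ (3₄ , t≡s³)
  ... | no t≢s | no t≢s² | no t≢s³ = inj₁ (St , t≢s , t≢s² , t≢s³)

  T-inv : ∀ {t} → T t → T (t ⁻¹)
  T-inv {t} Tt = T-intro (S-inv t (T⊆S Tt)) λ e t⁻¹≡σe →
    T-not-power Tt (-₄ e) (trans (sym (⁻¹-involutive t)) (trans (cong _⁻¹ t⁻¹≡σe) (sym (σ-inverse e))))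

  T⊆H : ∀ {t} → T t → H t
  T⊆H {t} (St , t≢s , _ , t≢s³) =
    subst H (identityˡ t) (gen-mul gen-ε (St , t≢s , λ t≡s⁻¹ → t≢s³ (trans t≡s⁻¹ (sym σ3≡s⁻¹))))

  reachable-in-H : ∀ {y n} → Walk G T ε y n → H y
  reachable-in-H w = walk-in-subgroup T⊆H w gen-ε

  even-power : ∀ r → H (σ r) → r ≡ 0₄ ⊎ r ≡ 2₄
  even-power 0₄ _ = inj₁ refl
  even-power 1₄ σ1∈H = ⊥-elim (s∉H (subst H σ1≡s σ1∈H))
  even-power 2₄ _ = inj₂ refl
  even-power 3₄ σ3∈H = ⊥-elim (s∉H (subst H σ3⁻¹≡s (gen-inv σ3∈H)))
    where
    σ3⁻¹≡s : σ 3₄ ⁻¹ ≡ s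
    σ3⁻¹≡s = trans (cong _⁻¹ σ3≡s⁻¹) (⁻¹-involutive s)

  even-shift : ∀ {w} r → H w → H (w ∙ σ r) → r ≡ 0₄ ⊎ r ≡ 2₄
  even-shift {w} r Hw Hwσ = even-power r (subst H (\\-leftDividesʳ w (σ r)) (gen-closed (gen-inv Hw) Hwσ))

  decompose : ∀ {a b L} → Walk G S a b L → ∃[ k ] ∃[ n ] (Walk G T a (b ∙ σ k) n × weight k + n ≤ L)
  decompose {b = b} nil = 0₄ , 0 , subst (λ v → Walk G T b v 0) (sym (identityʳ b)) nil , z≤n
  decompose {a} {b} {suc L} (cons {y = a′} (t , St , a′≡at) w) with decompose w | classify St
  ... | k , n , wT , k+n≤L | inj₁ Tt =
    k , suc n , cons (t , Tt , a′≡at) wT , subst (_≤ suc L) (sym (+-suc (weight k) n)) (s≤s k+n≤L)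
  ... | k , n , wT , k+n≤L | inj₂ (e , refl) =
    k +₄ (-₄ e) , n , translate (σ (-₄ e)) start end wT ,
    ≤-trans (+-monoˡ-≤ n (weight≤1 (k +₄ (-₄ e)))) (s≤s (m+n≤o⇒n≤o (weight k) k+n≤L))
    where
    start : a ≡ σ (-₄ e) ∙ a′
    start = trans (σ-unshift e a′≡at) (comm a′ (σ (-₄ e)))
    end : b ∙ σ (k +₄ (-₄ e)) ≡ σ (-₄ e) ∙ (b ∙ σ k)
    end = sym (trans (comm (σ (-₄ e)) (b ∙ σ k)) (σ-shift b k (-₄ e)))

  parity-decomposition : ∀ {w L} e → H w → Walk G S ε (w ∙ σ e) L →
    (∃[ n ] (Walk G T ε w n × weight e + n ≤ L)) ⊎
    (∃[ n ] (Walk G T ε (w ∙ σ 2₄) n × weight (e +₄ 2₄) + n ≤ L))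
  parity-decomposition {w} {L} e Hw walk with decompose walk
  ... | k , n , wT , k+n≤L = land (e +₄ k) refl (subst (λ v → Walk G T ε v n) (σ-shift w e k) wT)
    where
    land : ∀ r → e +₄ k ≡ r → Walk G T ε (w ∙ σ r) n →
      (∃[ n ] (Walk G T ε w n × weight e + n ≤ L)) ⊎
      (∃[ n ] (Walk G T ε (w ∙ σ 2₄) n × weight (e +₄ 2₄) + n ≤ L))
    land r e+k≡r wr with even-shift r Hw (reachable-in-H wr)
    ... | inj₁ refl = inj₁ (n , subst (λ v → Walk G T ε v n) (identityʳ w) wr ,
                             ≤-trans (+-monoˡ-≤ n (proj₁ (parity-cost e k) e+k≡r)) k+n≤L)
    ... | inj₂ refl = inj₂ (n , wr , ≤-trans (+-monoˡ-≤ n (proj₂ (parity-cost e k) e+k≡r)) k+n≤L)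

  coset-lower-bound : ∀ {w r} e → H w →
    (∀ n → Walk G T ε w n → r ≤ weight e + n) →
    (∀ n → Walk G T ε (w ∙ σ 2₄) n → r ≤ weight (e +₄ 2₄) + n) →
    ∀ L → Walk G S ε (w ∙ σ e) L → r ≤ L
  coset-lower-bound e Hw via-w via-ws² L walk with parity-decomposition e Hw walk
  ... | inj₁ (n , wT , le) = ≤-trans (via-w n wT) le
  ... | inj₂ (n , wT , le) = ≤-trans (via-ws² n wT) le

  dist-times-s : ∀ {w i} → H w → Dist G S ε w i → (∀ n → Walk G T ε (w ∙ σ 2₄) n → i ≤ n) →
    Dist G S ε (w ∙ σ 1₄) (suc i)
  dist-times-s Hw dw far = mkDist (snoc (proj₁ dw) (σ 1₄ , σ1∈S , refl))
    (coset-lower-bound 1₄ Hw (λ n wT → s≤s (dist-lb dw (widen T⊆S wT))) (λ n wT → s≤s (far n wT)))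

  dist-before-times-s : ∀ {w i} → H w → Dist G S ε (w ∙ σ 1₄) i → (∀ n → Walk G T ε (w ∙ σ 2₄) n → i ≤ n) →
    ∃[ n ] (i ≡ suc n × Dist G S ε w n)
  dist-before-times-s Hw dws far with parity-decomposition 1₄ Hw (proj₁ dws)
  ... | inj₁ (n , wT , n<i) = n , dist-of-predecessor (σ 1₄ , σ1∈S , refl) dws (widen T⊆S wT) n<i
  ... | inj₂ (n , wT , n<i) = ⊥-elim (<⇒≱ n<i (far n wT))

  -- Around an anchor, the sets counted by c_{j+1} and a_{j+1} at (ε, u s) are those at (ε, u), moved by s.
  module Layer {j b : ℕ} (j≤b : j ≤ b) {u : Carrier} (du : Dist G T ε u j)
               (far : ∀ n → Walk G T ε (u ∙ σ 2₄) n → suc b ≤ n) where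

    u∈H : H u
    u∈H = reachable-in-H (proj₁ du)

    power-lower-bound : ∀ e L → Walk G S ε (u ∙ σ e) L → weight e + j ≤ L
    power-lower-bound e = coset-lower-bound e u∈H
      (λ n wT → +-monoʳ-≤ (weight e) (dist-lb du wT))
      (λ n wT → ≤-trans (+-monoˡ-≤ j (weight≤1 e))
                  (≤-trans (s≤s j≤b) (≤-trans (far n wT) (m≤n+m n (weight (e +₄ 2₄))))))

    power-level : ∀ e {i} → Dist G S ε (u ∙ σ e) i → i ≤ j → e ≡ 0₄
    power-level 0₄ _ _ = refl
    power-level 1₄ {i} d i≤j = ⊥-elim (≤⇒≯ i≤j (power-lower-bound 1₄ i (proj₁ d)))
    power-level 2₄ {i} d i≤j = ⊥-elim (≤⇒≯ i≤j (power-lower-bound 2₄ i (proj₁ d)))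
    power-level 3₄ {i} d i≤j = ⊥-elim (≤⇒≯ i≤j (power-lower-bound 3₄ i (proj₁ d)))

    dist-u : Dist G S ε u j
    dist-u = mkDist (widen T⊆S (proj₁ du))
      (λ L w → power-lower-bound 0₄ L (subst (λ v → Walk G S ε v L) (sym (identityʳ u)) w))

    dist-power : ∀ e → S (σ e) → Dist G S ε (u ∙ σ e) (weight e + j)
    dist-power e σe∈S = mkDist (walk e σe∈S) (power-lower-bound e)
      where
      walk : ∀ e → S (σ e) → Walk G S ε (u ∙ σ e) (weight e + j)
      walk 0₄ ε∈S = ⊥-elim (ε∉S ε∈S)
      walk 1₄ σ1∈S′ = snoc (proj₁ dist-u) (σ 1₄ , σ1∈S′ , refl)
      walk 2₄ σ2∈S = snoc (proj₁ dist-u) (σ 2₄ , σ2∈S , refl)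
      walk 3₄ σ3∈S′ = snoc (proj₁ dist-u) (σ 3₄ , σ3∈S′ , refl)

    far-neighbour : ∀ {t} → T t → ∀ n → Walk G T ε ((u ∙ t) ∙ σ 2₄) n → b ≤ n
    far-neighbour {t} Tt n w = ≤-pred (far (suc n) (snoc w (t ⁻¹ , T-inv Tt , back)))
      where
      back : u ∙ σ 2₄ ≡ ((u ∙ t) ∙ σ 2₄) ∙ t ⁻¹
      back = sym (trans (cong (_∙ t ⁻¹) (swapʳ u t (σ 2₄))) (//-rightDividesʳ t (u ∙ σ 2₄)))

    far-neighbour-by : ∀ {t i} → i ≤ b → T t → ∀ n → Walk G T ε ((u ∙ t) ∙ σ 2₄) n → i ≤ n
    far-neighbour-by i≤b Tt n w = ≤-trans i≤b (far-neighbour Tt n w)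

    u∙t∈H : ∀ {t} → T t → H (u ∙ t)
    u∙t∈H Tt = gen-closed u∈H (T⊆H Tt)

    C-recursion : ∀ z → CSet G S (suc j) ε (u ∙ σ 1₄) z ⇔ (z ≡ u ⊎ ∃[ w ] (CSet G S j ε u w × z ≡ w ∙ σ 1₄))
    C-recursion z = mk⇔ to from
      where
      to : CSet G S (suc j) ε (u ∙ σ 1₄) z → z ≡ u ⊎ ∃[ w ] (CSet G S j ε u w × z ≡ w ∙ σ 1₄)
      to (dz , t , St , refl) with classify St
      ... | inj₁ Tt with dist-before-times-s (u∙t∈H Tt) (dist-at (swapʳ u (σ 1₄) t) dz) (far-neighbour-by j≤b Tt)
      ...   | n , j≡1+n , dut =
        inj₂ (u ∙ t , subst (λ i → CSet G S i ε u (u ∙ t)) (sym j≡1+n) (dut , t , St , refl) , swapʳ u (σ 1₄) t)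
      to (dz , t , St , refl) | inj₂ (e , refl) =
        inj₁ (trans (σ-shift u 1₄ e) (trans (cong (λ r → u ∙ σ r) 1+e≡0) (identityʳ u)))
        where
        1+e≡0 : 1₄ +₄ e ≡ 0₄
        1+e≡0 = power-level (1₄ +₄ e) (dist-at (σ-shift u 1₄ e) dz) ≤-refl
      from : z ≡ u ⊎ ∃[ w ] (CSet G S j ε u w × z ≡ w ∙ σ 1₄) → CSet G S (suc j) ε (u ∙ σ 1₄) z
      from (inj₁ refl) = dist-u , σ 3₄ , σ3∈S , sym (trans (σ-shift u 1₄ 3₄) (identityʳ u))
      from (inj₂ (w , cw , refl)) with CSet-pred cw
      ... | j′ , j≡1+j′ , dw , t , St , refl with classify St
      ...   | inj₁ Tt =
        subst (Dist G S ε _) (sym j≡1+j′)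
          (dist-times-s (u∙t∈H Tt) dw (far-neighbour-by (≤-trans (n≤1+n j′) (subst (_≤ b) j≡1+j′ j≤b)) Tt)) ,
        t , St , swapʳ u t (σ 1₄)
      ...   | inj₂ (e , refl) =
        ⊥-elim (ε∉S (subst S (cong σ (power-level e dw (subst (j′ ≤_) (sym j≡1+j′) (n≤1+n j′)))) St))

    C-step : ∀ {c} → HasCard G (CSet G S j ε u) c → HasCard G (CSet G S (suc j) ε (u ∙ σ 1₄)) (suc c)
    C-step h = count-insert u (count-image (_∙ σ 1₄) (∙-cancelʳ (σ 1₄) _ _) h) u-new C-recursion
      where
      u-new : ¬ (∃[ w ] (CSet G S j ε u w × u ≡ w ∙ σ 1₄))
      u-new (w , cw , u≡ws) with CSet-pred cw
      ... | j′ , j≡1+j′ , dw , _ with power-level 3₄ (dist-at (σ-unshift 1₄ u≡ws) dw)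
                                        (subst (j′ ≤_) (sym j≡1+j′) (n≤1+n j′))
      ...   | ()

    module _ (σ2∈S : S (σ 2₄)) (j<b : j < b) where

      A-recursion : ∀ z → ASet G S (suc j) ε (u ∙ σ 1₄) z ⇔
        (z ≡ u ∙ σ 2₄ ⊎ (z ≡ u ∙ σ 3₄ ⊎ ∃[ w ] (ASet G S j ε u w × z ≡ w ∙ σ 1₄)))
      A-recursion z = mk⇔ to from
        where
        to : ASet G S (suc j) ε (u ∙ σ 1₄) z →
          z ≡ u ∙ σ 2₄ ⊎ (z ≡ u ∙ σ 3₄ ⊎ ∃[ w ] (ASet G S j ε u w × z ≡ w ∙ σ 1₄))
        to (dz , t , St , refl) with classify St
        ... | inj₁ Tt with dist-before-times-s (u∙t∈H Tt) (dist-at (swapʳ u (σ 1₄) t) dz) (far-neighbour-by j<b Tt)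
        ...   | n , 1+j≡1+n , dut =
          inj₂ (inj₂ (u ∙ t , (subst (Dist G S ε (u ∙ t)) (sym (suc-injective 1+j≡1+n)) dut , t , St , refl) ,
                      swapʳ u (σ 1₄) t))
        to (dz , t , St , refl) | inj₂ (0₄ , refl) = ⊥-elim (ε∉S St)
        to (dz , t , St , refl) | inj₂ (1₄ , refl) = inj₁ (σ-shift u 1₄ 1₄)
        to (dz , t , St , refl) | inj₂ (2₄ , refl) = inj₂ (inj₁ (σ-shift u 1₄ 2₄))
        to (dz , t , St , refl) | inj₂ (3₄ , refl) =
          ⊥-elim (1+n≢n (dist-unique (dist-at (trans (σ-shift u 1₄ 3₄) (identityʳ u)) dz) dist-u))
        from : z ≡ u ∙ σ 2₄ ⊎ (z ≡ u ∙ σ 3₄ ⊎ ∃[ w ] (ASet G S j ε u w × z ≡ w ∙ σ 1₄)) →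
          ASet G S (suc j) ε (u ∙ σ 1₄) z
        from (inj₁ refl) = dist-power 2₄ σ2∈S , σ 1₄ , σ1∈S , sym (σ-shift u 1₄ 1₄)
        from (inj₂ (inj₁ refl)) = dist-power 3₄ σ3∈S , σ 2₄ , σ2∈S , sym (σ-shift u 1₄ 2₄)
        from (inj₂ (inj₂ (w , (dw , t , St , refl) , refl))) with classify St
        ... | inj₁ Tt = dist-times-s (u∙t∈H Tt) dw (far-neighbour-by j≤b Tt) , t , St , swapʳ u t (σ 1₄)
        ... | inj₂ (e , refl) = ⊥-elim (ε∉S (subst S (cong σ (power-level e dw ≤-refl)) St))

      A-step : ∀ {a} → HasCard G (ASet G S j ε u) a → HasCard G (ASet G S (suc j) ε (u ∙ σ 1₄)) (suc (suc a))
      A-step h =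
        count-insert (u ∙ σ 2₄)
          (count-insert (u ∙ σ 3₄) (count-image (_∙ σ 1₄) (∙-cancelʳ (σ 1₄) _ _) h) us³-new (λ _ → ⇔-refl))
          us²-new A-recursion
        where
        us³-new : ¬ (∃[ w ] (ASet G S j ε u w × u ∙ σ 3₄ ≡ w ∙ σ 1₄))
        us³-new (w , (dw , _) , us³≡ws)
          with power-level 2₄ (dist-at (trans (σ-unshift 1₄ us³≡ws) (σ-shift u 3₄ 3₄)) dw) ≤-refl
        ... | ()
        us²-new : ¬ (u ∙ σ 2₄ ≡ u ∙ σ 3₄ ⊎ ∃[ w ] (ASet G S j ε u w × u ∙ σ 2₄ ≡ w ∙ σ 1₄))
        us²-new (inj₁ us²≡us³)
          with power-level 3₄ (dist-at (trans (σ-unshift 3₄ us²≡us³) (σ-shift u 2₄ 1₄)) dist-u) ≤-refl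
        ... | ()
        us²-new (inj₂ (w , (dw , _) , us²≡ws))
          with power-level 1₄ (dist-at (trans (σ-unshift 1₄ us²≡ws) (σ-shift u 2₄ 3₄)) dw) ≤-refl
        ... | ()

  Anchor : ℕ → ℕ → Set
  Anchor j b = ∃[ u ] (Dist G T ε u j × (∀ n → Walk G T ε (u ∙ σ 2₄) n → suc b ≤ n))

  DefinesD : Carrier → ℕ → Set
  DefinesD x d = (¬ Reach G T x (x ∙ σ 2₄) × IsComponentDiameter G T x d) ⊎
                 (∃[ m ] (Dist G T x (x ∙ σ 2₄) m × d ≡ (m ∸ 1) / 2))

  -- on a Γ₁-geodesic from ε to s² of length m, the vertex at level j with 2j < m is an anchor:
  -- a short walk to u s², followed by the way back through u, would reach s² in fewer than m steps
  anchor-on-geodesic : ∀ {m} → Dist G T ε (σ 2₄) m → ∀ j → j + j < m → Anchor j j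
  anchor-on-geodesic dm j 2j<m with dist-prefix j (≤-trans (m≤m+n j j) (<⇒≤ 2j<m)) dm
  ... | u , du = u , du , λ n w →
    +-cancelʳ-≤ j (suc j) n (≤-trans 2j<m (dist-lb dm (detour T-inv (proj₁ du) w)))

  anchors-when-connected : ∀ {x m d} → σ 2₄ ≢ ε → Dist G T x (x ∙ σ 2₄) m → d ≡ (m ∸ 1) / 2 →
    ∀ j → j ≤ d → Anchor j j
  anchors-when-connected {x} {zero} s²≢ε dm _ _ _ =
    ⊥-elim (s²≢ε (∙-cancelˡ x (σ 2₄) ε (trans (sym (walk-zero (proj₁ dm))) (sym (identityʳ x)))))
  anchors-when-connected {x} {suc m} _ dm refl j j≤d =
    anchor-on-geodesic (dist-translate (x ⁻¹) (sym (inverseˡ x)) (sym (\\-leftDividesʳ x (σ 2₄))) dm)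
      j (s≤s (double-≤ j≤d))

  -- if x s² is not reachable from x in Γ₁, then u s² is never reachable from ε when u is,
  -- and a diametral geodesic of the component provides anchors with any slack at levels j ≤ d
  anchors-when-apart : ∀ {x d} → ¬ Reach G T x (x ∙ σ 2₄) → IsComponentDiameter G T x d →
    ∀ j → j ≤ d → ∀ b → Anchor j b
  anchors-when-apart {x} apart (_ , u₀ , v₀ , _ , _ , d₀) j j≤d b
    with dist-prefix j j≤d (dist-translate (u₀ ⁻¹) (sym (inverseˡ u₀)) refl d₀)
  ... | u , du = u , du , λ n w →
    ⊥-elim (apart (n + j , translate x (sym (identityʳ x)) refl (detour T-inv (proj₁ du) w)))

  generator-dist : ∀ {t} → S t → Dist G S ε t 1
  generator-dist {t} St = mkDist (cons (t , St , sym (identityˡ t)) nil) longer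
    where
    longer : ∀ n → Walk G S ε t n → 1 ≤ n
    longer zero w = ⊥-elim (ε∉S (subst S (sym (walk-zero w)) St))
    longer (suc n) _ = s≤s z≤n

  one-step : ∀ {z} → Walk G S ε z 1 → S z
  one-step (cons (t , St , y≡εt) nil) = subst S (trans (sym (identityˡ t)) (sym y≡εt)) St

  -- a₁ > 0 forces s² ∈ S: a common neighbour z = s t of ε and s cannot have z, t ∈ T (as s ∉ H),
  -- and the remaining cases put s² in S or ε in S
  square-in-S : ∀ {a} → ANum G S 1 (suc a) → S (σ 2₄)
  square-in-S a₁ with count-inhabited (a₁ ε (σ 1₄) (generator-dist σ1∈S))
  ... | z , dz , t , St , refl with classify St | one-step (proj₁ dz)
  ...   | inj₂ (0₄ , refl) | _ = ⊥-elim (ε∉S St)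
  ...   | inj₂ (1₄ , refl) | z∈S = subst S (σ-+ 1₄ 1₄) z∈S
  ...   | inj₂ (2₄ , refl) | _ = St
  ...   | inj₂ (3₄ , refl) | z∈S = ⊥-elim (ε∉S (subst S (σ-+ 1₄ 3₄) z∈S))
  ...   | inj₁ Tt | z∈S with classify z∈S
  ...     | inj₁ Tz = ⊥-elim (s∉H (subst H (trans (//-rightDividesʳ t (σ 1₄)) σ1≡s)
                                        (gen-closed (T⊆H Tz) (gen-inv (T⊆H Tt)))))
  ...     | inj₂ (e , z≡σe) = ⊥-elim (T-not-power Tt (e +₄ 3₄)
                                (trans (σ-unshift 1₄ (trans (sym z≡σe) (comm (σ 1₄) t))) (σ-+ e 3₄)))

  module IntersectionNumbers (DR : DistanceRegular G S) where

    D : ℕ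
    D = proj₁ (proj₂ DR)

    diameter : IsDiameter G S D
    diameter = proj₁ (proj₂ (proj₂ DR))

    within-diameter : ∀ {v i} → Dist G S ε v i → i ≤ D
    within-diameter {v} {i} = proj₁ diameter ε v i

    c-exists : ∀ {i} → i ≤ D → ∃[ c ] CNum G S i c
    c-exists i≤D with proj₂ (proj₂ (proj₂ DR)) _ i≤D
    ... | c , _ , _ , cn , _ = c , cn

    a-exists : ∀ {i} → i ≤ D → ∃[ a ] ANum G S i a
    a-exists i≤D with proj₂ (proj₂ (proj₂ DR)) _ i≤D
    ... | _ , a , _ , _ , an , _ = a , an

    dist-ε : Dist G S ε ε 0
    dist-ε = nil , λ _ ()

    c₀ : ∀ v → CNum G S 0 v → v ≡ 0
    c₀ v cn = count-empty (λ _ ()) (cn ε ε dist-ε)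

    a₀ : ∀ v → ANum G S 0 v → v ≡ 0
    a₀ v an = count-empty ε-has-no-loop (an ε ε dist-ε)
      where
      ε-has-no-loop : ∀ z → ¬ ASet G S 0 ε ε z
      ε-has-no-loop z (dz , t , St , z≡εt) =
        ε∉S (subst S (trans (sym (identityˡ t)) (trans (sym z≡εt) (sym (walk-zero (proj₁ dz))))) St)

    above-anchor : ∀ {d b} → d ≤ b → Anchor d b → suc d ≤ D
    above-anchor d≤b (u , du , far) = within-diameter (Layer.dist-power d≤b du far 1₄ σ1∈S)

    c-recurrence : ∀ {j} → Anchor j j → ∀ v → CNum G S (suc j) v → ∃[ c ] (CNum G S j c × v ≡ 1 + c)
    c-recurrence {j} (u , du , far) v cn =
      proj₁ cⱼ , proj₂ cⱼ , count-unique (cn ε (u ∙ σ 1₄) (dist-power 1₄ σ1∈S)) (C-step (proj₂ cⱼ ε u dist-u))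
      where
      open Layer ≤-refl du far
      cⱼ : ∃[ c ] CNum G S j c
      cⱼ = c-exists (within-diameter dist-u)

    a-recurrence : ∀ {j} → S (σ 2₄) → Anchor j (suc j) → ∀ v → ANum G S (suc j) v →
      ∃[ a ] (ANum G S j a × v ≡ 2 + a)
    a-recurrence {j} σ2∈S (u , du , far) v an =
      proj₁ aⱼ , proj₂ aⱼ ,
      count-unique (an ε (u ∙ σ 1₄) (dist-power 1₄ σ1∈S)) (A-step σ2∈S ≤-refl (proj₂ aⱼ ε u dist-u))
      where
      open Layer (n≤1+n j) du far
      aⱼ : ∃[ a ] ANum G S j a
      aⱼ = a-exists (within-diameter dist-u)

    c-at-level : ∀ {d} → (∀ j → j ≤ d → Anchor j j) → IntersectionC G S (suc d) (suc d)
    c-at-level {d} anchors = (D , diameter , 1+d≤D) , subst (CNum G S (suc d)) c≡1+d (proj₂ c₁₊d)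
      where
      1+d≤D : suc d ≤ D
      1+d≤D = above-anchor ≤-refl (anchors d ≤-refl)
      c₁₊d : ∃[ c ] CNum G S (suc d) c
      c₁₊d = c-exists 1+d≤D
      c≡1+d : proj₁ c₁₊d ≡ suc d
      c≡1+d = trans
        (arithmetic-progression (CNum G S) 1 (suc d) c₀ (λ j j≤d → c-recurrence (anchors j (≤-pred j≤d)))
          (suc d) ≤-refl _ (proj₂ c₁₊d))
        (*-identityʳ (suc d))

    a-at-level : ∀ {d} → S (σ 2₄) → (∀ j → j ≤ d → Anchor j (suc j)) → IntersectionA G S (suc d) (2 * suc d)
    a-at-level {d} σ2∈S anchors = (D , diameter , 1+d≤D) , subst (ANum G S (suc d)) a≡2+2d (proj₂ a₁₊d)
      where
      1+d≤D : suc d ≤ D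
      1+d≤D = above-anchor (n≤1+n d) (anchors d ≤-refl)
      a₁₊d : ∃[ a ] ANum G S (suc d) a
      a₁₊d = a-exists 1+d≤D
      a≡2+2d : proj₁ a₁₊d ≡ 2 * suc d
      a≡2+2d = trans
        (arithmetic-progression (ANum G S) 2 (suc d) a₀
          (λ j j≤d → a-recurrence σ2∈S (anchors j (≤-pred j≤d))) (suc d) ≤-refl _ (proj₂ a₁₊d))
        (*-comm (suc d) 2)

open FinAbGroup using (Carrier; _∙_; ε; _⁻¹)

lemma7p8 : (G : FinAbGroup) (S : Carrier G → Set) (s : Carrier G) →
    (∀ g → S g → S ((_⁻¹) G g)) → ¬ S (ε G) → (∃[ k ] (HasCard G S k × 3 ≤ k)) →
    S s →
    let H = Gen G (λ g → S g × g ≢ s × g ≢ (_⁻¹) G s)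
        T = λ g → S g × g ≢ s × g ≢ pow G s 2 × g ≢ pow G s 3
    in
    (∃[ g ] ¬ H g) → (∃[ h ] (HasCard G H h × FinAbGroup.size G ≡ 2 * h)) →
    HasOrder G s 4 → (∃[ g ] ¬ Gen G (λ t → t ≡ s) g) →
    DistanceRegular G S → ANum G S 1 2 →
    (x : Carrier G) → H x → (d : ℕ) →
    ((¬ Reach G T x (_∙_ G x (pow G s 2)) × IsComponentDiameter G T x d) ⊎
     (∃[ m ] (Dist G T x (_∙_ G x (pow G s 2)) m × d ≡ (m ∸ 1) / 2))) →
    IntersectionC G S (suc d) (suc d) ×
    (¬ Reach G T x (_∙_ G x (pow G s 2)) → IntersectionA G S (suc d) (2 * suc d))
lemma7p8 G S s S-inv ε∉S _ s∈S H≠G _ ord _ DR a₁ x _ d d-def = c-part d-def , a-part d-def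
  where
  open CosetGeometry G S s S-inv ε∉S s∈S (proj₁ (proj₂ ord)) (generator-outside G S s (proj₁ DR) H≠G)
  open IntersectionNumbers DR
  open PowersOfOrderFour G s (proj₁ (proj₂ ord)) using (σ)

  s²≢ε : σ 2₄ ≢ ε G
  s²≢ε = proj₂ (proj₂ ord) 2 (s≤s z≤n) (s≤s (s≤s (s≤s z≤n)))

  c-part : DefinesD x d → IntersectionC G S (suc d) (suc d)
  c-part (inj₁ (apart , component)) = c-at-level (λ j j≤d → anchors-when-apart apart component j j≤d j)
  c-part (inj₂ (m , dm , d≡)) = c-at-level (anchors-when-connected s²≢ε dm d≡)

  a-part : DefinesD x d → ¬ Reach G T x (_∙_ G x (σ 2₄)) → IntersectionA G S (suc d) (2 * suc d)
  a-part (inj₁ (_ , component)) apart =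
    a-at-level (square-in-S a₁) (λ j j≤d → anchors-when-apart apart component j j≤d (suc j))
  a-part (inj₂ (m , dm , _)) apart = ⊥-elim (apart (m , proj₁ dm))
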